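{- Let $m\ge 3$, $n\ge 2$ and $2\le l\le\lceil n/2\rceil$. For every positive integer $k$, $$\chi^b_{B_l(m,n)}(2k)=\Big[\sum_{i=0}^{m-2}(-1)^i(2k-1)^{(m-2)-i}\Big]\,\chi^b_{B_l(m,n-1)}(2k).$$
   Context: A signed graph $(G,\sigma)$ is a finite graph $G$ with a sign function $\sigma:E(G)\to\{+1,-1\}$; its signature is the set of negative edges. A zero-free signed coloring in $2k$ colors is a map $c:V(G)\to\{ -k,\dots,-1,1,\dots,k\}$; it is proper if $c(y)\neq\sigma(e)c(x)$ for every edge $e=xy$. The balanced chromatic polynomial $\chi^b_{(G,\sigma)}(2k)$ is the number of proper zero-free signed colorings in $2k$ colors. For integers $m\ge 3$, $n\ge 1$, the Book graph $B(m,n)$ has vertex set $\{u,v\}\cup\{u_j^l:1\le l\le n,\,1\le j\le m-2\}$ and consists of the $n$ cycles $u\,u_1^l\cdots u_{m-2}^l\,v\,u$ sharing the edge $uv$. For $1\le l\le n$, $B_l(m,n)$ denotes $B(m,n)$ with signature $\{uu_1^1,\dots,uu_1^l\}$. -}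

module Defs where

open import Data.Nat as ℕ using (ℕ; zero; suc; _∸_; _<_)
open import Data.Integer as ℤ using (ℤ; +_; -_)
open import Data.Fin as Fin using (Fin; toℕ; _↑ˡ_; _↑ʳ_; combine)
open import Data.List as List using (List; []; _∷_; _++_; [_]; map; concatMap; length; filter; allFin; upTo)
open import Data.List.Relation.Unary.All using (All; all?)
open import Data.Product using (_×_; _,_)
open import Relation.Nullary using (¬_; ¬?)
open import Relation.Binary.PropositionalEquality using (_≢_)
open import Data.Vec.Functional as VF using (Vector)

data Sign : Set where
  pos neg : Sign

sgn : Sign → ℤ
sgn pos = + 1
sgn neg = - (+ 1)

-- A finite signed (multi)graph on vertex set Fin nV; each edge is
-- (x , y , σ(e)).  Properness is symmetric in x,y since σ(e) = ±1.
record SignedGraph : Set where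
  constructor mkSG
  field
    nV    : ℕ
    edges : List (Fin nV × Fin nV × Sign)

-- Zero-free signed colorings in 2k colors: values in {-k..-1,1..k}.
-- A colour (s , j) stands for the integer s·(j+1).

Colour : ℕ → Set
Colour k = Sign × Fin k

val : ∀ {k} → Colour k → ℤ
val (s , j) = sgn s ℤ.* (+ suc (toℕ j))

allColours : (k : ℕ) → List (Colour k)
allColours k = map (pos ,_) (allFin k) ++ map (neg ,_) (allFin k)

allFuns : ∀ {A : Set} (N : ℕ) → List A → List (Vector A N)
allFuns zero    xs = [ (λ ()) ]
allFuns (suc N) xs = concatMap (λ a → map (λ f → a VF.∷ f) (allFuns N xs)) xs

module _ (G : SignedGraph) where
  open SignedGraph G

  ProperEdge : ∀ {k} → Vector (Colour k) nV → (Fin nV × Fin nV × Sign) → Set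
  ProperEdge c (x , y , s) = val (c y) ≢ sgn s ℤ.* val (c x)

  Proper : ∀ {k} → Vector (Colour k) nV → Set
  Proper c = All (ProperEdge c) edges

  proper? : ∀ {k} (c : Vector (Colour k) nV) → Relation.Nullary.Dec (Proper c)
  proper? c = all? (λ { (x , y , s) → ¬? (val (c y) ℤ.≟ sgn s ℤ.* val (c x)) }) edges

  -- balanced chromatic polynomial evaluated at 2k
  χᵇ : (k : ℕ) → ℕ
  χᵇ k = length (filter proper? (allFuns nV (allColours k)))

-- Book graphs.  d = m - 2 internal vertices per page.
-- Vertices: u = 0, v = 1, u_{j+1}^{p+1} = 2 + (p·d + j) for p : Fin n, j : Fin d.

module Book (d n : ℕ) where
  N : ℕ
  N = 2 ℕ.+ n ℕ.* d

  u v : Fin N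
  u = Fin.zero
  v = Fin.suc Fin.zero

  w : Fin n → Fin d → Fin N
  w p j = 2 ↑ʳ combine p j

  pathEdges : List (Fin N) → List (Fin N × Fin N × Sign)
  pathEdges (x ∷ y ∷ rest) = (x , y , pos) ∷ pathEdges (y ∷ rest)
  pathEdges _              = []

  pageEdges : Sign → Fin n → List (Fin N × Fin N × Sign)
  pageEdges s p with map (w p) (allFin d)
  ... | []     = []
  ... | x ∷ xs = (u , x , s) ∷ pathEdges (x ∷ xs ++ [ v ])

  signOf : ℕ → Fin n → Sign
  signOf L p with toℕ p ℕ.<? L
  ... | Relation.Nullary.yes _ = neg
  ... | Relation.Nullary.no  _ = pos

  -- B_L(m,n): negative edges u u_1^1, ..., u u_1^L
  graph : ℕ → SignedGraph
  graph L = mkSG N ((u , v , pos) ∷ concatMap (λ p → pageEdges (signOf L p) p) (allFin n))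

B : (L m n : ℕ) → SignedGraph
B L m n = Book.graph (m ∸ 2) n L

factor : (m k : ℕ) → ℤ
factor m k = List.foldr ℤ._+_ (+ 0)
  (map (λ i → (- (+ 1)) ℤ.^ i ℤ.* (+ (2 ℕ.* k ∸ 1)) ℤ.^ ((m ∸ 2) ∸ i)) (upTo (suc (m ∸ 2))))

-- Write d = m - 2 and r = 2k - 1.  A colouring of B_L(m,n) is a choice of
-- colours a = c(u), b = c(v) together with a colouring of the d interior
-- vertices of every page.  Counting with 0/1 indicators, the indicator of
-- properness factorises over the edges, hence
--     χᵇ = Σ_{a,b} [a,b proper on uv] · Π_pages (number of proper page colourings).
-- Since L ≤ ⌈n/2⌉ ≤ n - 1, the last page carries only positive edges, and the
-- number of proper colourings of such a page is the number walks d a b of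
-- proper paths a, x_1, …, x_d, b.  Removing the last step of a path gives
--     walks (d+1) a b + walks d a b = r^(d+1)        for all colours a, b,
-- so for a ≠ b, by induction, walks d a b = Σ_{i=0}^{d} (-1)^i r^(d-i), the
-- factor of the theorem, independently of a and b.  Pulling this constant
-- out of the sum over (a,b) leaves exactly χᵇ(B_L(m,n-1)).
module Submission where

open import Defs
open import Data.Nat using (ℕ; _≤_; _∸_; ⌈_/2⌉)
open import Data.Integer using (+_; _*_)
open import Relation.Binary.PropositionalEquality using (_≡_)

open import Data.Bool using (true; false; if_then_else_)
open import Data.Empty using (⊥-elim)
open import Data.Unit using (tt)
open import Data.Fin using (Fin; toℕ; combine; _↑ˡ_; _↑ʳ_; inject₁; fromℕ)
import Data.Fin as Fin
import Data.Fin.Properties as FinP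
open import Data.Integer using (ℤ; _-_)
import Data.Integer as ℤ
import Data.Integer.Properties as ℤP
open import Data.List using (List; []; _∷_; _++_; [_]; map; concatMap; filter; length; allFin; tabulate; applyUpTo; foldr)
import Data.List.Properties as ListP
open import Data.List.Relation.Unary.All using (all?)
open import Data.Nat using (zero; suc; _+_; _^_; _<?_; s≤s) renaming (_*_ to _·_)
import Data.Nat.Properties as ℕP
open import Algebra.Properties.Monoid.Sum ℕP.*-1-monoid using (sum-cong-≗; sum-init-last) renaming (sum to ∏)
open import Data.Nat.Tactic.RingSolver using (solve-∀)
open import Data.Product using (_×_; _,_)
open import Data.Product.Properties using (,-injective)
open import Data.Vec.Functional using (Vector; head; tail) renaming (_∷_ to _∷ᵛ_)
open import Relation.Binary.Definitions using (DecidableEquality)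
open import Relation.Binary.PropositionalEquality
  using (_≢_; _≗_; refl; sym; trans; cong; cong₂; module ≡-Reasoning)
open import Relation.Nullary using (Dec; yes; no; does; ¬?; _×-dec_)
open import Relation.Nullary.Decidable using (map′)
open import Relation.Unary using (Pred; Decidable)

ind : {A : Set} → Dec A → ℕ
ind a? = if does a? then 1 else 0

ind-cong : {A B : Set} (a? : Dec A) (b? : Dec B) → (A → B) → (B → A) → ind a? ≡ ind b?
ind-cong (yes _) (yes _) _   _   = refl
ind-cong (yes a) (no ¬b) a→b _   = ⊥-elim (¬b (a→b a))
ind-cong (no ¬a) (yes b) _   b→a = ⊥-elim (¬a (b→a b))
ind-cong (no _)  (no _)  _   _   = refl

ind-× : {A B : Set} (a? : Dec A) (b? : Dec B) → ind (a? ×-dec b?) ≡ ind a? · ind b?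
ind-× a? b? with does a? | does b?
... | true  | true  = refl
... | true  | false = refl
... | false | _     = refl

ind-¬ : {A : Set} (a? : Dec A) → ind (¬? a?) + ind a? ≡ 1
ind-¬ a? with does a?
... | true  = refl
... | false = refl

∑ : {A : Set} → List A → (A → ℕ) → ℕ
∑ []       f = 0
∑ (x ∷ xs) f = f x + ∑ xs f

∏ℓ : {A : Set} → List A → (A → ℕ) → ℕ
∏ℓ []       f = 1
∏ℓ (x ∷ xs) f = f x · ∏ℓ xs f

module _ {A : Set} where

  ∑-cong : (xs : List A) {f g : A → ℕ} → (∀ x → f x ≡ g x) → ∑ xs f ≡ ∑ xs g
  ∑-cong []       f≗g = refl
  ∑-cong (x ∷ xs) f≗g = cong₂ _+_ (f≗g x) (∑-cong xs f≗g)

  ∑-++ : (xs ys : List A) (f : A → ℕ) → ∑ (xs ++ ys) f ≡ ∑ xs f + ∑ ys f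
  ∑-++ []       ys f = refl
  ∑-++ (x ∷ xs) ys f = trans (cong (_+_ (f x)) (∑-++ xs ys f)) (sym (ℕP.+-assoc (f x) _ _))

  ∑-map : {B : Set} (h : B → A) (xs : List B) (f : A → ℕ) → ∑ (map h xs) f ≡ ∑ xs (λ x → f (h x))
  ∑-map h []       f = refl
  ∑-map h (x ∷ xs) f = cong (_+_ (f (h x))) (∑-map h xs f)

  ∑-concatMap : {B : Set} (h : B → List A) (xs : List B) (f : A → ℕ) →
                ∑ (concatMap h xs) f ≡ ∑ xs (λ x → ∑ (h x) f)
  ∑-concatMap h []       f = refl
  ∑-concatMap h (x ∷ xs) f =
    trans (∑-++ (h x) (concatMap h xs) f) (cong (_+_ (∑ (h x) f)) (∑-concatMap h xs f))

  ∑-+ : (xs : List A) (f g : A → ℕ) → ∑ xs f + ∑ xs g ≡ ∑ xs (λ x → f x + g x)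
  ∑-+ []       f g = refl
  ∑-+ (x ∷ xs) f g = trans (shuffle (f x) (g x) (∑ xs f) (∑ xs g)) (cong (_+_ (f x + g x)) (∑-+ xs f g))
    where
    shuffle : ∀ a b s t → a + s + (b + t) ≡ a + b + (s + t)
    shuffle = solve-∀

  ∑-*ˡ : (xs : List A) (c : ℕ) (f : A → ℕ) → ∑ xs (λ x → c · f x) ≡ c · ∑ xs f
  ∑-*ˡ []       c f = sym (ℕP.*-zeroʳ c)
  ∑-*ˡ (x ∷ xs) c f = trans (cong (_+_ (c · f x)) (∑-*ˡ xs c f)) (sym (ℕP.*-distribˡ-+ c (f x) (∑ xs f)))

  ∑-*ʳ : (xs : List A) (c : ℕ) (f : A → ℕ) → ∑ xs (λ x → f x · c) ≡ ∑ xs f · c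
  ∑-*ʳ []       c f = refl
  ∑-*ʳ (x ∷ xs) c f = trans (cong (_+_ (f x · c)) (∑-*ʳ xs c f)) (sym (ℕP.*-distribʳ-+ c (f x) (∑ xs f)))

  ∑-zero : (xs : List A) → ∑ xs (λ _ → 0) ≡ 0
  ∑-zero []       = refl
  ∑-zero (_ ∷ xs) = ∑-zero xs

  length-filter : {P : Pred A _} (P? : Decidable P) (xs : List A) →
                  length (filter P? xs) ≡ ∑ xs (λ x → ind (P? x))
  length-filter P? []       = refl
  length-filter P? (x ∷ xs) with does (P? x)
  ... | true  = cong suc (length-filter P? xs)
  ... | false = length-filter P? xs

  ∑-point : (_≟_ : DecidableEquality A) (a : A) (g : A → ℕ) (xs : List A) →
            ∑ xs (λ x → ind (x ≟ a) · g x) ≡ ∑ xs (λ x → ind (x ≟ a)) · g a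
  ∑-point _≟_ a g []       = refl
  ∑-point _≟_ a g (x ∷ xs) with x ≟ a
  ... | yes refl = cong₂ _+_ (ℕP.*-identityˡ (g x)) (∑-point _≟_ a g xs)
  ... | no _     = ∑-point _≟_ a g xs

  ind-all : {P : Pred A _} (P? : Decidable P) (xs : List A) → ind (all? P? xs) ≡ ∏ℓ xs (λ x → ind (P? x))
  ind-all P? []       = refl
  ind-all P? (x ∷ xs) = trans (ind-× (P? x) (all? P? xs)) (cong (ind (P? x) ·_) (ind-all P? xs))

  ∏ℓ-++ : (xs ys : List A) (f : A → ℕ) → ∏ℓ (xs ++ ys) f ≡ ∏ℓ xs f · ∏ℓ ys f
  ∏ℓ-++ []       ys f = sym (ℕP.+-identityʳ _)
  ∏ℓ-++ (x ∷ xs) ys f = trans (cong (f x ·_) (∏ℓ-++ xs ys f)) (sym (ℕP.*-assoc (f x) _ _))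

  ∏ℓ-concatMap : {B : Set} {n : ℕ} (t : Fin n → B) (E : B → List A) (f : A → ℕ) →
                 ∏ℓ (concatMap E (tabulate t)) f ≡ ∏ (λ p → ∏ℓ (E (t p)) f)
  ∏ℓ-concatMap {n = zero}  t E f = refl
  ∏ℓ-concatMap {n = suc n} t E f =
    trans (∏ℓ-++ (E (t Fin.zero)) _ f) (cong (∏ℓ (E (t Fin.zero)) f ·_) (∏ℓ-concatMap (λ p → t (Fin.suc p)) E f))

∑-allFin-suc : {n : ℕ} (f : Fin (suc n) → ℕ) → ∑ (allFin (suc n)) f ≡ f Fin.zero + ∑ (allFin n) (λ j → f (Fin.suc j))
∑-allFin-suc {n} f =
  cong (_+_ (f Fin.zero)) (trans (cong (λ js → ∑ js f) (sym (ListP.map-tabulate (λ j → j) Fin.suc))) (∑-map Fin.suc (allFin n) f))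

allFin-once : {n : ℕ} (i : Fin n) → ∑ (allFin n) (λ j → ind (j FinP.≟ i)) ≡ 1
allFin-once {suc n} Fin.zero    = trans (∑-allFin-suc {n} (λ j → ind (j FinP.≟ Fin.zero))) (cong suc (∑-zero (allFin n)))
allFin-once {suc n} (Fin.suc i) = trans (∑-allFin-suc {n} (λ j → ind (j FinP.≟ Fin.suc i))) (allFin-once i)

∑-allFin-one : (n : ℕ) → ∑ (allFin n) (λ _ → 1) ≡ n
∑-allFin-one zero    = refl
∑-allFin-one (suc n) = trans (∑-allFin-suc {n} (λ _ → 1)) (cong suc (∑-allFin-one n))

module AllFunctions {A : Set} (xs : List A) where

  ∑F : (N : ℕ) → (Vector A N → ℕ) → ℕ
  ∑F N w = ∑ (allFuns N xs) w

  Extensional : {N : ℕ} → (Vector A N → ℕ) → Set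
  Extensional w = ∀ {f g} → f ≗ g → w f ≡ w g

  ∑F-suc : (N : ℕ) (w : Vector A (suc N) → ℕ) → ∑F (suc N) w ≡ ∑ xs (λ x → ∑F N (λ h → w (x ∷ᵛ h)))
  ∑F-suc N w = trans (∑-concatMap _ xs w) (∑-cong xs (λ x → ∑-map (x ∷ᵛ_) (allFuns N xs) w))

  ∑F-product : (N₁ N₂ : ℕ) (w₁ : Vector A N₁ → ℕ) (w₂ : Vector A N₂ → ℕ) → Extensional w₁ →
               ∑F (N₁ + N₂) (λ f → w₁ (λ i → f (i ↑ˡ N₂)) · w₂ (λ j → f (N₁ ↑ʳ j))) ≡ ∑F N₁ w₁ · ∑F N₂ w₂
  ∑F-product zero N₂ w₁ w₂ ext = begin
      ∑F N₂ (λ f → w₁ (λ i → f (i ↑ˡ N₂)) · w₂ f)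
    ≡⟨ ∑-cong (allFuns N₂ xs) (λ f → cong (_· w₂ f) (ext (λ ()))) ⟩
      ∑F N₂ (λ f → w₁ (λ ()) · w₂ f)
    ≡⟨ ∑-*ˡ (allFuns N₂ xs) (w₁ (λ ())) w₂ ⟩
      w₁ (λ ()) · ∑F N₂ w₂
    ≡⟨ cong (_· ∑F N₂ w₂) (sym (ℕP.+-identityʳ (w₁ (λ ())))) ⟩
      ∑F zero w₁ · ∑F N₂ w₂
    ∎
    where open ≡-Reasoning
  ∑F-product (suc N₁) N₂ w₁ w₂ ext = begin
      ∑F (suc (N₁ + N₂)) (λ f → w₁ (λ i → f (i ↑ˡ N₂)) · w₂ (λ j → f (suc N₁ ↑ʳ j)))
    ≡⟨ ∑F-suc (N₁ + N₂) _ ⟩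
      ∑ xs (λ x → ∑F (N₁ + N₂) (λ h → w₁ (λ i → (x ∷ᵛ h) (i ↑ˡ N₂)) · w₂ (λ j → h (N₁ ↑ʳ j))))
    ≡⟨ ∑-cong xs (λ x → ∑-cong (allFuns (N₁ + N₂) xs) (λ h → cong (_· w₂ (λ j → h (N₁ ↑ʳ j))) (ext (cons-↑ˡ x h)))) ⟩
      ∑ xs (λ x → ∑F (N₁ + N₂) (λ h → w₁ (x ∷ᵛ (λ i → h (i ↑ˡ N₂))) · w₂ (λ j → h (N₁ ↑ʳ j))))
    ≡⟨ ∑-cong xs (λ x → ∑F-product N₁ N₂ (λ t → w₁ (x ∷ᵛ t)) w₂ (λ f≗g → ext (cons-cong x f≗g))) ⟩
      ∑ xs (λ x → ∑F N₁ (λ t → w₁ (x ∷ᵛ t)) · ∑F N₂ w₂)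
    ≡⟨ ∑-*ʳ xs (∑F N₂ w₂) _ ⟩
      ∑ xs (λ x → ∑F N₁ (λ t → w₁ (x ∷ᵛ t))) · ∑F N₂ w₂
    ≡⟨ cong (_· ∑F N₂ w₂) (sym (∑F-suc N₁ w₁)) ⟩
      ∑F (suc N₁) w₁ · ∑F N₂ w₂
    ∎
    where
    open ≡-Reasoning
    cons-↑ˡ : (x : A) (h : Vector A (N₁ + N₂)) → (λ i → (x ∷ᵛ h) (i ↑ˡ N₂)) ≗ x ∷ᵛ (λ i → h (i ↑ˡ N₂))
    cons-↑ˡ x h Fin.zero    = refl
    cons-↑ˡ x h (Fin.suc i) = refl
    cons-cong : (x : A) {f g : Vector A N₁} → f ≗ g → x ∷ᵛ f ≗ x ∷ᵛ g
    cons-cong x f≗g Fin.zero    = refl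
    cons-cong x f≗g (Fin.suc i) = f≗g i

  ∑F-pages : (d n : ℕ) (w : Fin n → Vector A d → ℕ) → (∀ p → Extensional (w p)) →
             ∑F (n · d) (λ g → ∏ (λ p → w p (λ j → g (combine p j)))) ≡ ∏ (λ p → ∑F d (w p))
  ∑F-pages d zero    w ext = refl
  ∑F-pages d (suc n) w ext =
    trans (∑F-product d (n · d) (w Fin.zero) (λ g → ∏ (λ p → w (Fin.suc p) (λ j → g (combine p j)))) (ext Fin.zero))
          (cong (∑F d (w Fin.zero) ·_) (∑F-pages d n (λ p → w (Fin.suc p)) (λ p → ext (Fin.suc p))))

open AllFunctions using (∑F; ∑F-suc; ∑F-pages)

_≟ˢ_ : DecidableEquality Sign
pos ≟ˢ pos = yes refl
pos ≟ˢ neg = no (λ ())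
neg ≟ˢ pos = no (λ ())
neg ≟ˢ neg = yes refl

module Colours (k : ℕ) where

  tagged : Sign → List (Colour k)
  tagged t = map (t ,_) (allFin k)

  cols : List (Colour k)
  cols = tagged pos ++ tagged neg

  ∑-cols : (f : Colour k → ℕ) → ∑ cols f ≡ ∑ (allFin k) (λ j → f (pos , j)) + ∑ (allFin k) (λ j → f (neg , j))
  ∑-cols f = trans (∑-++ (tagged pos) (tagged neg) f) (cong₂ _+_ (∑-map (pos ,_) (allFin k) f) (∑-map (neg ,_) (allFin k) f))

  _≟ᶜ_ : DecidableEquality (Colour k)
  (s , i) ≟ᶜ (t , j) = map′ (λ (s≡t , i≡j) → cong₂ _,_ s≡t i≡j) ,-injective (s ≟ˢ t ×-dec i FinP.≟ j)

  val-pos : (i : Fin k) → val (pos , i) ≡ + suc (toℕ i)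
  val-pos i = ℤP.*-identityˡ _

  val-neg : (i : Fin k) → val (neg , i) ≡ ℤ.-[1+ toℕ i ]
  val-neg i = ℤP.-1*i≡-i _

  val-injective : (x y : Colour k) → val x ≡ val y → x ≡ y
  val-injective (pos , i) (pos , j) e =
    cong (pos ,_) (FinP.toℕ-injective (ℕP.suc-injective (ℤP.+-injective (trans (sym (val-pos i)) (trans e (val-pos j))))))
  val-injective (pos , i) (neg , j) e with trans (sym (val-pos i)) (trans e (val-neg j))
  ... | ()
  val-injective (neg , i) (pos , j) e with trans (sym (val-neg i)) (trans e (val-pos j))
  ... | ()
  val-injective (neg , i) (neg , j) e =
    cong (neg ,_) (FinP.toℕ-injective (ℤP.-[1+-injective (trans (sym (val-neg i)) (trans e (val-neg j)))))

  ok : Sign → Colour k → Colour k → ℕ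
  ok s a x = ind (¬? (val x ℤ.≟ sgn s ℤ.* val a))

  clash→≡ : (a x : Colour k) → val x ≡ sgn pos ℤ.* val a → x ≡ a
  clash→≡ a x e = val-injective x a (trans e (ℤP.*-identityˡ (val a)))

  ≡→clash : (a x : Colour k) → x ≡ a → val x ≡ sgn pos ℤ.* val a
  ≡→clash a x refl = sym (ℤP.*-identityˡ (val x))

  ok-complement : (a x : Colour k) → ok pos a x + ind (x ≟ᶜ a) ≡ 1
  ok-complement a x =
    trans (cong (_+_ (ok pos a x)) (ind-cong (x ≟ᶜ a) (val x ℤ.≟ _) (≡→clash a x) (clash→≡ a x)))
          (ind-¬ (val x ℤ.≟ sgn pos ℤ.* val a))

  ok-sym : (a x : Colour k) → ok pos a x ≡ ok pos x a
  ok-sym a x = ind-cong (¬? (val x ℤ.≟ _)) (¬? (val a ℤ.≟ _))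
    (λ ¬e e → ¬e (≡→clash a x (sym (clash→≡ x a e))))
    (λ ¬e e → ¬e (≡→clash x a (sym (clash→≡ a x e))))

  ok-self : (a : Colour k) → ok pos a a ≡ 0
  ok-self a = ind-cong (¬? (val a ℤ.≟ _)) (no (λ ())) (λ ¬e → ¬e (≡→clash a a refl)) (λ ())

  ok-distinct : {a b : Colour k} → a ≢ b → ok pos a b ≡ 1
  ok-distinct {a} {b} a≢b = ind-cong (¬? (val b ℤ.≟ _)) (yes tt) _ (λ _ e → a≢b (sym (clash→≡ a b e)))

  cols-once : (a : Colour k) → ∑ cols (λ x → ind (x ≟ᶜ a)) ≡ 1
  cols-once (s , i) = begin
      ∑ cols (λ x → ind (x ≟ᶜ (s , i)))
    ≡⟨ trans (∑-cols (λ x → ind (x ≟ᶜ (s , i)))) (cong₂ _+_ (block pos) (block neg)) ⟩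
      ind (pos ≟ˢ s) · 1 + ind (neg ≟ˢ s) · 1
    ≡⟨ signs s ⟩
      1
    ∎
    where
    open ≡-Reasoning
    block : (t : Sign) → ∑ (allFin k) (λ j → ind ((t , j) ≟ᶜ (s , i))) ≡ ind (t ≟ˢ s) · 1
    block t = trans (∑-cong (allFin k) (λ j → ind-× (t ≟ˢ s) (j FinP.≟ i)))
                    (trans (∑-*ˡ (allFin k) (ind (t ≟ˢ s)) _) (cong (_·_ (ind (t ≟ˢ s))) (allFin-once i)))
    signs : (s : Sign) → ind (pos ≟ˢ s) · 1 + ind (neg ≟ˢ s) · 1 ≡ 1
    signs pos = refl
    signs neg = refl

  ∑-delete : (a : Colour k) (g : Colour k → ℕ) → ∑ cols (λ x → ok pos a x · g x) + g a ≡ ∑ cols g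
  ∑-delete a g = begin
      ∑ cols (λ x → ok pos a x · g x) + g a
    ≡⟨ cong (_+_ (∑ cols (λ x → ok pos a x · g x))) (sym (trans (cong (_· g a) (cols-once a)) (ℕP.*-identityˡ (g a)))) ⟩
      ∑ cols (λ x → ok pos a x · g x) + ∑ cols (λ x → ind (x ≟ᶜ a)) · g a
    ≡⟨ cong (_+_ (∑ cols (λ x → ok pos a x · g x))) (sym (∑-point _≟ᶜ_ a g cols)) ⟩
      ∑ cols (λ x → ok pos a x · g x) + ∑ cols (λ x → ind (x ≟ᶜ a) · g x)
    ≡⟨ ∑-+ cols _ _ ⟩
      ∑ cols (λ x → ok pos a x · g x + ind (x ≟ᶜ a) · g x)
    ≡⟨ ∑-cong cols (λ x → trans (sym (ℕP.*-distribʳ-+ (g x) (ok pos a x) _))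
                               (trans (cong (_· g x) (ok-complement a x)) (ℕP.*-identityˡ (g x)))) ⟩
      ∑ cols g
    ∎
    where open ≡-Reasoning

  ∑-ok : (a : Colour k) → ∑ cols (ok pos a) ≡ 2 · k ∸ 1
  ∑-ok a = begin
      ∑ cols (ok pos a)
    ≡⟨ sym (ℕP.m+n∸n≡m _ 1) ⟩
      ∑ cols (ok pos a) + 1 ∸ 1
    ≡⟨ cong (λ s → s + 1 ∸ 1) (∑-cong cols (λ x → sym (ℕP.*-identityʳ (ok pos a x)))) ⟩
      ∑ cols (λ x → ok pos a x · 1) + 1 ∸ 1
    ≡⟨ cong (_∸ 1) (∑-delete a (λ _ → 1)) ⟩
      ∑ cols (λ _ → 1) ∸ 1
    ≡⟨ cong (_∸ 1) (trans (∑-cols (λ _ → 1)) (cong₂ _+_ (∑-allFin-one k) (trans (∑-allFin-one k) (sym (ℕP.+-identityʳ k))))) ⟩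
      2 · k ∸ 1
    ∎
    where open ≡-Reasoning

∑ℤ : ℕ → (ℕ → ℤ) → ℤ
∑ℤ n f = foldr ℤ._+_ (+ 0) (applyUpTo f n)

∑ℤ-cong : (n : ℕ) {f g : ℕ → ℤ} → (∀ i → f i ≡ g i) → ∑ℤ n f ≡ ∑ℤ n g
∑ℤ-cong zero    f≗g = refl
∑ℤ-cong (suc n) f≗g = cong₂ ℤ._+_ (f≗g 0) (∑ℤ-cong n (λ i → f≗g (suc i)))

∑ℤ-neg : (n : ℕ) (f : ℕ → ℤ) → ∑ℤ n (λ i → ℤ.- f i) ≡ ℤ.- ∑ℤ n f
∑ℤ-neg zero    f = refl
∑ℤ-neg (suc n) f = trans (cong (ℤ._+_ (ℤ.- f 0)) (∑ℤ-neg n (λ i → f (suc i)))) (sym (ℤP.neg-distrib-+ (f 0) _))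

alternating : ℤ → ℕ → ℤ
alternating R d = ∑ℤ (suc d) (λ i → (ℤ.- + 1) ℤ.^ i * R ℤ.^ (d ∸ i))

factor≡alternating : (m k : ℕ) → factor m k ≡ alternating (+ (2 · k ∸ 1)) (m ∸ 2)
factor≡alternating m k = cong (foldr ℤ._+_ (+ 0))
  (ListP.map-applyUpTo (λ i → i) (λ i → (ℤ.- + 1) ℤ.^ i * (+ (2 · k ∸ 1)) ℤ.^ ((m ∸ 2) ∸ i)) (suc (m ∸ 2)))

alternating-suc : (R : ℤ) (d : ℕ) → alternating R (suc d) ≡ R ℤ.^ suc d - alternating R d
alternating-suc R d = cong₂ ℤ._+_ (ℤP.*-identityˡ (R ℤ.^ suc d)) (begin
    ∑ℤ (suc d) (λ i → (ℤ.- + 1) ℤ.^ suc i * R ℤ.^ (d ∸ i))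
  ≡⟨ ∑ℤ-cong (suc d) (λ i → trans (ℤP.*-assoc (ℤ.- + 1) ((ℤ.- + 1) ℤ.^ i) (R ℤ.^ (d ∸ i))) (ℤP.-1*i≡-i _)) ⟩
    ∑ℤ (suc d) (λ i → ℤ.- ((ℤ.- + 1) ℤ.^ i * R ℤ.^ (d ∸ i)))
  ≡⟨ ∑ℤ-neg (suc d) (λ i → (ℤ.- + 1) ℤ.^ i * R ℤ.^ (d ∸ i)) ⟩
    ℤ.- alternating R d
  ∎)
  where open ≡-Reasoning

pos-^ : (r n : ℕ) → (+ r) ℤ.^ n ≡ + (r ^ n)
pos-^ r zero    = refl
pos-^ r (suc n) = trans (cong (+ r *_) (pos-^ r n)) (sym (ℤP.pos-* r (r ^ n)))

pos-difference : {x y z : ℕ} → x + y ≡ z → + x ≡ + z - + y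
pos-difference {x} {y} refl = begin
    + x                        ≡⟨ sym (ℤP.+-identityʳ (+ x)) ⟩
    + x ℤ.+ + 0                ≡⟨ cong (ℤ._+_ (+ x)) (sym (ℤP.+-inverseʳ (+ y))) ⟩
    + x ℤ.+ (+ y - + y)        ≡⟨ sym (ℤP.+-assoc (+ x) (+ y) (ℤ.- + y)) ⟩
    (+ x ℤ.+ + y) - + y        ≡⟨ cong (_- + y) (sym (ℤP.pos-+ x y)) ⟩
    + (x + y) - + y            ∎
  where open ≡-Reasoning

module Walks (k : ℕ) where
  open Colours k
  open AllFunctions cols using (Extensional)

  r : ℕ
  r = 2 · k ∸ 1

  walk : (d : ℕ) → Colour k → Colour k → Vector (Colour k) d → ℕ
  walk zero    a b h = ok pos a b
  walk (suc d) a b h = ok pos a (head h) · walk d (head h) b (tail h)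

  page : {d : ℕ} → Sign → Colour k → Colour k → Vector (Colour k) (suc d) → ℕ
  page {d} s a b h = ok s a (head h) · walk d (head h) b (tail h)

  walk-ext : (d : ℕ) (a b : Colour k) → Extensional (walk d a b)
  page-ext : {d : ℕ} (s : Sign) (a b : Colour k) → Extensional (page {d} s a b)

  walk-ext zero    a b f≗g = refl
  walk-ext (suc d) a b     = page-ext pos a b

  page-ext {d} s a b {f} {g} f≗g =
    cong₂ _·_ (cong (ok s a) (f≗g Fin.zero))
              (trans (cong (λ x → walk d x b (tail f)) (f≗g Fin.zero)) (walk-ext d (g Fin.zero) b (λ i → f≗g (Fin.suc i))))

  walks : ℕ → Colour k → Colour k → ℕ
  walks d a b = ∑F cols d (walk d a b)

  walks-zero : (a b : Colour k) → walks 0 a b ≡ ok pos a b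
  walks-zero a b = ℕP.+-identityʳ (ok pos a b)

  walks-suc : (d : ℕ) (a b : Colour k) → walks (suc d) a b ≡ ∑ cols (λ x → ok pos a x · walks d x b)
  walks-suc d a b = trans (∑F-suc cols d (walk (suc d) a b))
                          (∑-cong cols (λ x → ∑-*ˡ (allFuns d cols) (ok pos a x) (walk d x b)))

  -- Dropping the constraint at b: the paths a, x₁, …, x_{d+1} number r^(d+1),
  -- and those with x_{d+1} = b are the proper paths a, x₁, …, x_d, b.
  walks-recurrence : (d : ℕ) (a b : Colour k) → walks (suc d) a b + walks d a b ≡ r ^ suc d
  walks-recurrence zero a b = begin
      walks 1 a b + walks 0 a b
    ≡⟨ cong₂ _+_ (trans (walks-suc 0 a b) (∑-cong cols (λ x → cong (ok pos a x ·_) (walks-zero x b)))) (walks-zero a b) ⟩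
      ∑ cols (λ x → ok pos a x · ok pos x b) + ok pos a b
    ≡⟨ ∑-delete a (λ x → ok pos x b) ⟩
      ∑ cols (λ x → ok pos x b)
    ≡⟨ ∑-cong cols (λ x → ok-sym x b) ⟩
      ∑ cols (ok pos b)
    ≡⟨ trans (∑-ok b) (sym (ℕP.*-identityʳ r)) ⟩
      r ^ 1
    ∎
    where open ≡-Reasoning
  walks-recurrence (suc d) a b = begin
      walks (suc (suc d)) a b + walks (suc d) a b
    ≡⟨ cong₂ _+_ (walks-suc (suc d) a b) (walks-suc d a b) ⟩
      ∑ cols (λ x → ok pos a x · walks (suc d) x b) + ∑ cols (λ x → ok pos a x · walks d x b)
    ≡⟨ ∑-+ cols _ _ ⟩
      ∑ cols (λ x → ok pos a x · walks (suc d) x b + ok pos a x · walks d x b)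
    ≡⟨ ∑-cong cols (λ x → trans (sym (ℕP.*-distribˡ-+ (ok pos a x) _ _)) (cong (ok pos a x ·_) (walks-recurrence d x b))) ⟩
      ∑ cols (λ x → ok pos a x · r ^ suc d)
    ≡⟨ ∑-*ʳ cols (r ^ suc d) (ok pos a) ⟩
      ∑ cols (ok pos a) · r ^ suc d
    ≡⟨ cong (_· r ^ suc d) (∑-ok a) ⟩
      r ^ suc (suc d)
    ∎
    where open ≡-Reasoning

  walks-distinct : (d : ℕ) {a b : Colour k} → a ≢ b → + walks d a b ≡ alternating (+ r) d
  walks-distinct zero    {a} {b} a≢b = cong +_ (trans (walks-zero a b) (ok-distinct a≢b))
  walks-distinct (suc d) {a} {b} a≢b = begin
      + walks (suc d) a b
    ≡⟨ pos-difference (walks-recurrence d a b) ⟩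
      + (r ^ suc d) - + walks d a b
    ≡⟨ cong₂ _-_ (sym (pos-^ r (suc d))) (walks-distinct d a≢b) ⟩
      (+ r) ℤ.^ suc d - alternating (+ r) d
    ≡⟨ sym (alternating-suc (+ r) d) ⟩
      alternating (+ r) (suc d)
    ∎
    where open ≡-Reasoning

  walks-uniform : (d : ℕ) {a b a′ b′ : Colour k} → a ≢ b → a′ ≢ b′ → walks d a b ≡ walks d a′ b′
  walks-uniform d a≢b a′≢b′ = ℤP.+-injective (trans (walks-distinct d a≢b) (sym (walks-distinct d a′≢b′)))

  -- A positive page between u and v contributes the uniform factor when
  -- c(u) ≠ c(v), and the term vanishes anyway when c(u) = c(v).
  positive-page : (d : ℕ) {a′ b′ : Colour k} → a′ ≢ b′ → (a b : Colour k) (X : ℕ) →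
                  ok pos a b · (X · walks d a b) ≡ walks d a′ b′ · (ok pos a b · X)
  positive-page d {a′} {b′} _ a b X with a ≟ᶜ b
  positive-page d {a′} {b′} _ a b X | yes refl = begin
      ok pos a a · (X · walks d a a)   ≡⟨ cong (_· (X · walks d a a)) (ok-self a) ⟩
      0                                ≡⟨ sym (ℕP.*-zeroʳ (walks d a′ b′)) ⟩
      walks d a′ b′ · 0                ≡⟨ cong (λ o → walks d a′ b′ · (o · X)) (sym (ok-self a)) ⟩
      walks d a′ b′ · (ok pos a a · X) ∎
    where open ≡-Reasoning
  positive-page d {a′} {b′} a′≢b′ a b X | no a≢b = begin
      ok pos a b · (X · walks d a b)   ≡⟨ cong₂ (λ o w → o · (X · w)) (ok-distinct a≢b) (walks-uniform d a≢b a′≢b′) ⟩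
      1 · (X · walks d a′ b′)          ≡⟨ reorder X (walks d a′ b′) ⟩
      walks d a′ b′ · (1 · X)          ≡⟨ cong (λ o → walks d a′ b′ · (o · X)) (sym (ok-distinct a≢b)) ⟩
      walks d a′ b′ · (ok pos a b · X) ∎
    where
    open ≡-Reasoning
    reorder : ∀ x w → 1 · (x · w) ≡ w · (1 · x)
    reorder = solve-∀

edgeOK : {k N : ℕ} → Vector (Colour k) N → Fin N × Fin N × Sign → ℕ
edgeOK {k} c (x , y , s) = Colours.ok k s (c x) (c y)

χᵇ-as-sum : (G : SignedGraph) (k : ℕ) →
            χᵇ G k ≡ ∑F (allColours k) (SignedGraph.nV G) (λ c → ∏ℓ (SignedGraph.edges G) (edgeOK c))
χᵇ-as-sum G k = trans (length-filter (proper? G) (allFuns (SignedGraph.nV G) (allColours k)))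
                      (∑-cong (allFuns (SignedGraph.nV G) (allColours k)) (λ c → ind-all _ (SignedGraph.edges G)))

module BookCount (k d n : ℕ) where
  open Book (suc d) n
  open Colours k using (ok; cols)
  open Walks k using (walk; page; page-ext)

  path-weight : (c : Vector (Colour k) N) (e : ℕ) (G : Fin e → Fin N) (x : Fin N) →
                ∏ℓ (pathEdges (x ∷ tabulate G ++ [ v ])) (edgeOK c) ≡ walk e (c x) (c v) (λ j → c (G j))
  path-weight c zero    G x = ℕP.*-identityʳ _
  path-weight c (suc e) G x =
    cong (ok pos (c x) (c (G Fin.zero)) ·_) (path-weight c e (λ j → G (Fin.suc j)) (G Fin.zero))

  page-weight : (c : Vector (Colour k) N) (s : Sign) (p : Fin n) →
                ∏ℓ (pageEdges s p) (edgeOK c) ≡ page s (c u) (c v) (λ j → c (w p j))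
  page-weight c s p = cong (ok s (c u) (c (w p Fin.zero)) ·_)
    (trans (cong (λ ys → ∏ℓ (pathEdges (w p Fin.zero ∷ ys ++ [ v ])) (edgeOK c)) (ListP.map-tabulate Fin.suc (w p)))
           (path-weight c d (λ j → w p (Fin.suc j)) (w p Fin.zero)))

  pages : ℕ → Colour k → Colour k → ℕ
  pages L a b = ∏ (λ p → ∑F cols (suc d) (page (signOf L p) a b))

  χᵇ-book : (L : ℕ) → χᵇ (graph L) k ≡ ∑ cols (λ a → ∑ cols (λ b → ok pos a b · pages L a b))
  χᵇ-book L = begin
      χᵇ (graph L) k
    ≡⟨ χᵇ-as-sum (graph L) k ⟩
      ∑F cols N (λ c → ∏ℓ (SignedGraph.edges (graph L)) (edgeOK c))
    ≡⟨ ∑-cong (allFuns N cols) (λ c → cong (ok pos (c u) (c v) ·_) (edges-weight c)) ⟩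
      ∑F cols N (λ c → ok pos (c u) (c v) · ∏ (λ p → page (signOf L p) (c u) (c v) (λ j → c (w p j))))
    ≡⟨ trans (∑F-suc cols _ _) (∑-cong cols (λ a → ∑F-suc cols _ _)) ⟩
      ∑ cols (λ a → ∑ cols (λ b → ∑F cols (n · suc d) (λ g → ok pos a b · ∏ (λ p → page (signOf L p) a b (λ j → g (combine p j))))))
    ≡⟨ ∑-cong cols (λ a → ∑-cong cols (λ b → pull-out a b)) ⟩
      ∑ cols (λ a → ∑ cols (λ b → ok pos a b · pages L a b))
    ∎
    where
    open ≡-Reasoning
    edges-weight : (c : Vector (Colour k) N) →
      ∏ℓ (concatMap (λ p → pageEdges (signOf L p) p) (allFin n)) (edgeOK c)
        ≡ ∏ (λ p → page (signOf L p) (c u) (c v) (λ j → c (w p j)))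
    edges-weight c = trans (∏ℓ-concatMap (λ p → p) (λ p → pageEdges (signOf L p) p) (edgeOK c))
                           (sum-cong-≗ (λ p → page-weight c (signOf L p) p))
    pull-out : (a b : Colour k) →
      ∑F cols (n · suc d) (λ g → ok pos a b · ∏ (λ p → page (signOf L p) a b (λ j → g (combine p j))))
        ≡ ok pos a b · pages L a b
    pull-out a b = trans (∑-*ˡ (allFuns (n · suc d) cols) (ok pos a b) _)
                         (cong (ok pos a b ·_) (∑F-pages cols (suc d) n _ (λ p → page-ext (signOf L p) a b)))

signAt : ℕ → ℕ → Sign
signAt L i with i <? L
... | yes _ = neg
... | no  _ = pos

signOf≡signAt : (d n L : ℕ) (p : Fin n) → Book.signOf d n L p ≡ signAt L (toℕ p)
signOf≡signAt d n L p with toℕ p <? L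
... | yes _ = refl
... | no  _ = refl

signAt-pos : {L i : ℕ} → L ≤ i → signAt L i ≡ pos
signAt-pos {L} {i} L≤i with i <? L
... | yes i<L = ⊥-elim (ℕP.<⇒≱ i<L L≤i)
... | no  _   = refl

pages-add-page : (k d n L : ℕ) → L ≤ n → (a b : Colour k) →
                 BookCount.pages k d (suc n) L a b ≡ BookCount.pages k d n L a b · Walks.walks k (suc d) a b
pages-add-page k d n L L≤n a b =
  trans (sum-init-last (λ p → count (Book.signOf (suc d) (suc n) L p)))
        (cong₂ _·_ (sum-cong-≗ (λ p → cong count (earlier-signs p))) (cong count last-sign))
  where
  open Walks k using (page)
  count : Sign → ℕ
  count s = ∑F (Colours.cols k) (suc d) (page s a b)
  earlier-signs : (p : Fin n) → Book.signOf (suc d) (suc n) L (inject₁ p) ≡ Book.signOf (suc d) n L p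
  earlier-signs p = trans (signOf≡signAt (suc d) (suc n) L (inject₁ p))
                          (trans (cong (signAt L) (FinP.toℕ-inject₁ p)) (sym (signOf≡signAt (suc d) n L p)))
  last-sign : Book.signOf (suc d) (suc n) L (fromℕ n) ≡ pos
  last-sign = trans (signOf≡signAt (suc d) (suc n) L (fromℕ n))
                    (trans (cong (signAt L) (FinP.toℕ-fromℕ n)) (signAt-pos L≤n))

a₀ b₀ : {k′ : ℕ} → Colour (suc k′)
a₀ = pos , Fin.zero
b₀ = neg , Fin.zero

a₀≢b₀ : {k′ : ℕ} → a₀ {k′} ≢ b₀
a₀≢b₀ ()

χᵇ-add-page : (k′ d n L : ℕ) → L ≤ n →
  χᵇ (Book.graph (suc d) (suc n) L) (suc k′) ≡ Walks.walks (suc k′) (suc d) a₀ b₀ · χᵇ (Book.graph (suc d) n L) (suc k′)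
χᵇ-add-page k′ d n L L≤n = begin
    χᵇ (Book.graph (suc d) (suc n) L) k
  ≡⟨ BookCount.χᵇ-book k d (suc n) L ⟩
    ∑ cols (λ a → ∑ cols (λ b → ok pos a b · BookCount.pages k d (suc n) L a b))
  ≡⟨ ∑-cong cols (λ a → ∑-cong cols (λ b → factor-out a b)) ⟩
    ∑ cols (λ a → ∑ cols (λ b → D · (ok pos a b · BookCount.pages k d n L a b)))
  ≡⟨ trans (∑-cong cols (λ a → ∑-*ˡ cols D _)) (∑-*ˡ cols D _) ⟩
    D · ∑ cols (λ a → ∑ cols (λ b → ok pos a b · BookCount.pages k d n L a b))
  ≡⟨ cong (D ·_) (sym (BookCount.χᵇ-book k d n L)) ⟩
    D · χᵇ (Book.graph (suc d) n L) k
  ∎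
  where
  open ≡-Reasoning
  k = suc k′
  open Colours k using (cols; ok)
  open Walks k using (walks; positive-page)
  D = walks (suc d) a₀ b₀
  factor-out : (a b : Colour k) → ok pos a b · BookCount.pages k d (suc n) L a b ≡ D · (ok pos a b · BookCount.pages k d n L a b)
  factor-out a b = trans (cong (ok pos a b ·_) (pages-add-page k d n L L≤n a b))
                         (positive-page (suc d) a₀≢b₀ a b (BookCount.pages k d n L a b))

theorem7p8 : (m n L k : ℕ) → 3 ≤ m → 2 ≤ n → 2 ≤ L → L ≤ ⌈ n /2⌉ → 1 ≤ k →
    + χᵇ (B L m n) k ≡ factor m k * + χᵇ (B L m (n ∸ 1)) k
theorem7p8 m _ L k (s≤s (s≤s (s≤s {n = d} _))) (s≤s (s≤s {n = n} _)) _ L≤⌈n/2⌉ (s≤s {n = k′} _) =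
  trans (cong +_ (χᵇ-add-page k′ d (suc n) L L≤n+1))
        (trans (ℤP.pos-* (Walks.walks k (suc d) a₀ b₀) _)
               (cong (_* + χᵇ (B L m (suc n)) k) path-count))
  where
  L≤n+1 : L ≤ suc n
  L≤n+1 = ℕP.≤-trans L≤⌈n/2⌉ (s≤s (ℕP.⌈n/2⌉≤n n))
  path-count : + Walks.walks k (suc d) a₀ b₀ ≡ factor m k
  path-count = trans (Walks.walks-distinct k (suc d) a₀≢b₀) (sym (factor≡alternating m k))
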